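{- Let $\mathcal M=\langle(\mathcal C_i)_{i\in I},(\mathcal B_i)_{i\in I},(R_j)_{j\in J}\rangle$ be a model and $\mathcal G\in|\mathcal M|$. Then $\mathcal G=\mathcal G^\perp\leadsto\mathcal B_{w(\mathcal G)}$.
   Context: $\lambda\mu$-terms over disjoint infinite sets of $\lambda$-variables and $\mu$-variables: $t ::= x \mid \lambda x.t \mid (t\,t) \mid \mu\alpha.t \mid (\alpha\,t)$. $u[\alpha:=^*v]$ replaces inductively each subterm $(\alpha\,w)$ of $u$ by $(\alpha\,(w\,v))$. Reduction $\triangleright$: compatible closure of $(\lambda x.u\;v)\triangleright u[x:=v]$ and $(\mu\alpha.u\;v)\triangleright\mu\alpha.u[\alpha:=^*v]$; $\triangleright^*$ its reflexive transitive closure. $\mathcal T$ = set of terms, $\mathcal T^{<\omega}$ = set of finite sequences of terms; $(t\,\bar u)=(\dots(t\,u_1)\dots u_n)$, $(t\,\emptyset)=t$. A set $\mathcal S$ of terms is saturated if $v\triangleright^*u$ and $u\in\mathcal S$ imply $v\in\mathcal S$. $\mathcal K\leadsto\mathcal L=\{t\mid\forall u\in\mathcal K,(t\,u)\in\mathcal L\}$ for sets of terms; for $\mathcal X\subseteq\mathcal T^{<\omega}$, $\mathcal X\leadsto\mathcal L=\{t\mid\forall\bar u\in\mathcal X,(t\,\bar u)\in\mathcal L\}$. A model $\mathcal M=\langle(\mathcal C_i)_{i\in I},(\mathcal B_i)_{i\in I},(R_j)_{j\in J}\rangle$: $I,J\subseteq\mathbb N$, $0\in I$; $\mathcal C_i$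 pairwise disjoint infinite sets of $\mu$-variables; $\mathcal B_i$, $R_j$ non-empty saturated sets of terms; for all $i\in I$, if $\alpha\in\mathcal C_i$, $u\in\mathcal B_0$ then $\mu\alpha.u\in\mathcal B_i$, and if $\alpha\in\mathcal C_i$, $u\in\mathcal B_i$ then $(\alpha\,u)\in\mathcal B_0$; for each $j\in J$ there exist $i\in I$, $\mathcal X_j\subseteq\mathcal T^{<\omega}$ with $R_j=\mathcal X_j\leadsto\mathcal B_i$. $|\mathcal M|$ is the smallest set containing all $\mathcal B_i$, $R_j$ and closed under $\leadsto$. For $\mathcal G\in|\mathcal M|$ (such $\mathcal G$ is always of the form $\mathcal X\leadsto\mathcal B_i$ with $\mathcal X\subseteq\mathcal T^{<\omega}$, $i\in I$), $w(\mathcal G)$ is the smallest integer $i$ such that $\mathcal G=\mathcal X\leadsto\mathcal B_i$ for some $\mathcal X\subseteq\mathcal T^{<\omega}$, and $\mathcal G^\perp=\bigcup\{\mathcal X\subseteq\mathcal T^{<\omega}\mid\mathcal G=\mathcal X\leadsto\mathcal B_{w(\mathcal G)}\}$. -}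

module Defs where

open import Level using (Level; _⊔_) renaming (suc to lsuc; zero to lzero)
open import Data.Nat using (ℕ; zero; suc; _≤_; _<_) renaming (_⊔_ to _⊔ₙ_)
open import Data.List using (List; []; _∷_; foldl)
open import Data.Product using (Σ; _×_; _,_; proj₁; proj₂)
open import Data.Empty using (⊥)
open import Relation.Nullary using (¬_)
open import Relation.Binary.PropositionalEquality using (_≡_; _≢_)
open import Relation.Binary.Construct.Closure.ReflexiveTransitive using (Star)

-- λμ-terms.  λ-variables and μ-variables are both coded by natural
-- numbers, but live in separate syntactic positions, so the two sets
-- of variables are disjoint (and infinite).

data Term : Set where
  var : ℕ → Term
  lam : ℕ → Term → Term
  app : Term → Term → Term
  mu  : ℕ → Term → Term
  nam : ℕ → Term → Term

apps : Term → List Term → Term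
apps t us = foldl app t us

-- Capture-avoiding (simultaneous) substitution.
-- σ : λ-substitution (association list x ↦ term)
-- ρ : μ-part, α ↦ (β , ws): each subterm (α w) becomes (β (w' ws)),
--     where w' is the result of the substitution applied to w.

maxv : Term → ℕ
maxv (var x) = x
maxv (lam x t) = x ⊔ₙ maxv t
maxv (app t u) = maxv t ⊔ₙ maxv u
maxv (mu a t) = a ⊔ₙ maxv t
maxv (nam a t) = a ⊔ₙ maxv t

maxL : List Term → ℕ
maxL [] = 0
maxL (t ∷ ts) = maxv t ⊔ₙ maxL ts

LSub : Set
LSub = List (ℕ × Term)

MSub : Set
MSub = List (ℕ × (ℕ × List Term))

maxσ : LSub → ℕ
maxσ [] = 0
maxσ ((x , t) ∷ σ) = x ⊔ₙ maxv t ⊔ₙ maxσ σ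

maxρ : MSub → ℕ
maxρ [] = 0
maxρ ((a , b , ws) ∷ ρ) = a ⊔ₙ b ⊔ₙ maxL ws ⊔ₙ maxρ ρ

lookupλ : LSub → ℕ → Term
lookupλ [] x = var x
lookupλ ((y , t) ∷ σ) x with Data.Nat._≟_ x y
... | Relation.Nullary.yes _ = t
... | Relation.Nullary.no _ = lookupλ σ x

lookupμ : MSub → ℕ → ℕ × List Term
lookupμ [] a = a , []
lookupμ ((b , p) ∷ ρ) a with Data.Nat._≟_ a b
... | Relation.Nullary.yes _ = p
... | Relation.Nullary.no _ = lookupμ ρ a

fresh : LSub → MSub → Term → ℕ
fresh σ ρ t = suc (maxv t ⊔ₙ maxσ σ ⊔ₙ maxρ ρ)

sub : LSub → MSub → Term → Term
sub σ ρ (var x) = lookupλ σ x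
sub σ ρ (lam x t) = lam z (sub ((x , var z) ∷ σ) ρ t)
  where z = fresh σ ρ (lam x t)
sub σ ρ (app t u) = app (sub σ ρ t) (sub σ ρ u)
sub σ ρ (mu a t) = mu z (sub σ ((a , z , []) ∷ ρ) t)
  where z = fresh σ ρ (mu a t)
sub σ ρ (nam a t) = nam (proj₁ (lookupμ ρ a)) (apps (sub σ ρ t) (proj₂ (lookupμ ρ a)))

_[_:=_] : Term → ℕ → Term → Term
u [ x := v ] = sub ((x , v) ∷ []) [] u

_[_:=*_] : Term → ℕ → Term → Term
u [ a :=* v ] = sub [] ((a , a , v ∷ []) ∷ []) u

-- One-step reduction (compatible closure of the two redex rules),
-- together with α-conversion steps (terms are considered up to
-- α-equivalence in the paper).

data _▷_ : Term → Term → Set where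
  βλ   : ∀ {x u v} → app (lam x u) v ▷ (u [ x := v ])
  βμ   : ∀ {a u v} → app (mu a u) v ▷ mu a (u [ a :=* v ])
  lamc : ∀ {x t t'} → t ▷ t' → lam x t ▷ lam x t'
  appl : ∀ {t t' u} → t ▷ t' → app t u ▷ app t' u
  appr : ∀ {t u u'} → u ▷ u' → app t u ▷ app t u'
  muc  : ∀ {a t t'} → t ▷ t' → mu a t ▷ mu a t'
  namc : ∀ {a t t'} → t ▷ t' → nam a t ▷ nam a t'

data _≈α₁_ : Term → Term → Set where
  αλ   : ∀ {x y t} → maxv t < y → lam x t ≈α₁ lam y (t [ x := var y ])
  αμ   : ∀ {a b t} → maxv t < b → mu a t ≈α₁ mu b (sub [] ((a , b , []) ∷ []) t)
  lamc : ∀ {x t t'} → t ≈α₁ t' → lam x t ≈α₁ lam x t'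
  appl : ∀ {t t' u} → t ≈α₁ t' → app t u ≈α₁ app t' u
  appr : ∀ {t u u'} → u ≈α₁ u' → app t u ≈α₁ app t u'
  muc  : ∀ {a t t'} → t ≈α₁ t' → mu a t ≈α₁ mu a t'
  namc : ∀ {a t t'} → t ≈α₁ t' → nam a t ≈α₁ nam a t'

data Step : Term → Term → Set where
  red  : ∀ {t u} → t ▷ u → Step t u
  αfwd : ∀ {t u} → t ≈α₁ u → Step t u
  αbwd : ∀ {t u} → u ≈α₁ t → Step t u

_▷*_ : Term → Term → Set
_▷*_ = Star Step

SetT : Set₁
SetT = Term → Set

_≐_ : ∀ {a b} → (Term → Set a) → (Term → Set b) → Set (a ⊔ b)
K ≐ L = (∀ t → K t → L t) × (∀ t → L t → K t)

Saturated : SetT → Set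
Saturated S = ∀ u v → v ▷* u → S u → S v

NonEmpty : SetT → Set
NonEmpty S = Σ Term S

Infinite : (ℕ → Set) → Set
Infinite C = ∀ n → Σ ℕ λ m → n ≤ m × C m

_⇝_ : SetT → SetT → SetT
(K ⇝ L) t = ∀ u → K u → L (app t u)

-- X ⇝ L  for X ⊆ T^{<ω}
_⇛_ : ∀ {ℓ} → (List Term → Set ℓ) → SetT → Term → Set ℓ
(X ⇛ L) t = ∀ us → X us → L (apps t us)

-- Models.  I, J ⊆ ℕ are given as predicates; the families C, B, R are
-- indexed by all of ℕ but only their members with index in I (resp. J)
-- are ever used.

record Model : Set₁ where
  field
    I : ℕ → Set
    J : ℕ → Set
    C : ℕ → ℕ → Set
    B : ℕ → SetT
    R : ℕ → SetT
    0∈I     : I 0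
    C-inf   : ∀ i → I i → Infinite (C i)
    C-disj  : ∀ i k → I i → I k → i ≢ k → ∀ a → C i a → C k a → ⊥
    B-ne    : ∀ i → I i → NonEmpty (B i)
    B-sat   : ∀ i → I i → Saturated (B i)
    R-ne    : ∀ j → J j → NonEmpty (R j)
    R-sat   : ∀ j → J j → Saturated (R j)
    mu-cl   : ∀ i → I i → ∀ a u → C i a → B 0 u → B i (mu a u)
    nam-cl  : ∀ i → I i → ∀ a u → C i a → B i u → B 0 (nam a u)
    R-form  : ∀ j → J j → Σ ℕ λ i → I i × Σ (List Term → Set) λ X → R j ≐ (X ⇛ B i)

open Model public

-- |M| : smallest set of sets containing all B_i, R_j and closed under ⇝
-- (membership taken up to extensional equality of sets)
data InM (M : Model) : SetT → Set₁ where
  inB : ∀ {G} i → I M i → G ≐ B M i → InM M G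
  inR : ∀ {G} j → J M j → G ≐ R M j → InM M G
  inArr : ∀ {G K L} → InM M K → InM M L → G ≐ (K ⇝ L) → InM M G

FormAt : Model → SetT → ℕ → Set₁
FormAt M G i = Σ (List Term → Set) λ X → G ≐ (X ⇛ B M i)

-- IsW M G i  :⇔  i = w(G), i.e. i is the smallest integer (in I) with
-- G = X ⇝ B_i for some X.
IsW : Model → SetT → ℕ → Set₁
IsW M G i = I M i × FormAt M G i × (∀ k → k < i → I M k → ¬ FormAt M G k)

-- G^⊥ (relative to the index i = w(G)):
-- the union of all X with G = X ⇝ B_i.
Perp : Model → SetT → ℕ → List Term → Set₁
Perp M G i us = Σ (List Term → Set) λ X → (G ≐ (X ⇛ B M i)) × X us

module Submission where

-- Fix a set of terms L.  Call X ⊆ T^{<ω} a representation of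
-- G over L when G = X ⇝ L, and let Reps G L be the union of all such X.
-- The operator X ↦ X ⇝ L is antitone, and it turns unions into
-- intersections.  Hence
--   * every t ∈ G sends every sequence of the union into L, since each
--     sequence lies in some representation X and G = X ⇝ L;
--   * conversely, if G has at least one representation X, then X ⊆ Reps G L,
--     so by antitonicity Reps G L ⇝ L ⊆ X ⇝ L = G.
-- So G = Reps G L ⇝ L as soon as G has some representation over L.
-- For the theorem, G^⊥ is by definition Reps G B_{w(G)}, and the defining
-- property of w(G) provides a representation over B_{w(G)}.

open import Defs
open import Data.Nat using (ℕ)
open import Data.List using (List)
open import Data.Product using (Σ; _×_; _,_; proj₁; proj₂)

Reps : SetT → SetT → List Term → Set₁
Reps G L us = Σ (List Term → Set) λ X → (G ≐ (X ⇛ L)) × X us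

⇛-antitone : ∀ {a b} {X : List Term → Set a} {Y : List Term → Set b} (L : SetT) →
             (∀ us → X us → Y us) → ∀ t → (Y ⇛ L) t → (X ⇛ L) t
⇛-antitone L X⊆Y t t∈Y⇛L us us∈X = t∈Y⇛L us (X⊆Y us us∈X)

rep⊆Reps : ∀ G L {X : List Term → Set} → G ≐ (X ⇛ L) → ∀ us → X us → Reps G L us
rep⊆Reps G L {X} G≐X⇛L us us∈X = X , G≐X⇛L , us∈X

⊆Reps⇛ : ∀ G L t → G t → (Reps G L ⇛ L) t
⊆Reps⇛ G L t t∈G us (X , G≐X⇛L , us∈X) = proj₁ G≐X⇛L t t∈G us us∈X

Reps⇛⊆ : ∀ G L {X : List Term → Set} → G ≐ (X ⇛ L) → ∀ t → (Reps G L ⇛ L) t → G t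
Reps⇛⊆ G L G≐X⇛L t t∈Reps⇛L =
  proj₂ G≐X⇛L t (⇛-antitone L (rep⊆Reps G L G≐X⇛L) t t∈Reps⇛L)

Reps-represents : ∀ G L {X : List Term → Set} → G ≐ (X ⇛ L) → G ≐ (Reps G L ⇛ L)
Reps-represents G L G≐X⇛L = ⊆Reps⇛ G L , Reps⇛⊆ G L G≐X⇛L

-- Lemma 2.16: G = G^⊥ ⇝ B_{w(G)}.  Here G^⊥ = Perp M G i is definitionally
-- Reps G (B M i), and i = w(G) comes with a representation of G over B_i.
lemma2p16 : (M : Model) (G : SetT) → InM M G → (i : ℕ) → IsW M G i → G ≐ (Perp M G i ⇛ B M i)
lemma2p16 M G _ i (_ , (X , G≐X⇛Bi) , _) = Reps-represents G (B M i) G≐X⇛Bi
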